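{- For a positive integer $\ell$, consider the statement $P(\ell)$: "for all finite lists $\mathcal{A}_1,\mathcal{A}_2$ of vectors in $\mathbb{Z}^\ell$ with $r_{\mathcal{A}_2}=\ell$ such that $\#\mathrm{CW}(\mathcal{A}_1,\mathcal{A}_2,\mathbb{Z}^\ell;q)=0$ for every $q\in\mathbb{Z}_{>0}$, there exists $\alpha\in\mathcal{A}_1$ with $\alpha\in\langle\mathcal{A}_2\rangle$." Then $P(\ell)$ holds if and only if $\ell=1$.
   Context: $\langle\mathcal{A}_2\rangle$ is the subgroup of $\mathbb{Z}^\ell$ generated by $\mathcal{A}_2$, and $r_{\mathcal{A}_2}$ is its rank. For finite lists $\mathcal{A},\mathcal{B}$ in $\mathbb{Z}^\ell$, regarded as integer matrices with the vectors as columns, and $q\in\mathbb{Z}_{>0}$, $\mathrm{CW}(\mathcal{A},\mathcal{B},\mathbb{Z}^\ell;q):=\{\mathbf{z}\in(\mathbb{Z}/q\mathbb{Z})^\ell \mid \mathbf{z}\cdot\mathcal{A}\in((\mathbb{Z}/q\mathbb{Z})\smallsetminus\{\overline0\})^{\#\mathcal{A}},\ \mathbf{z}\cdot\mathcal{B}=(\overline0)^{\#\mathcal{B}}\}$, with $\mathbf{z}$ a row vector. -}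

module Defs where

open import Data.Nat using (ℕ; suc)
open import Data.Integer using (ℤ; +_; _+_; _*_; 0ℤ)
open import Data.Integer.Divisibility using (_∣_)
open import Data.Fin using (Fin; toℕ)
open import Data.List using (List; length)
open import Data.List.Membership.Propositional using (_∈_)
open import Data.List.Relation.Unary.All using (All)
open import Data.Vec using (Vec; []; _∷_; replicate; zipWith; map; foldr; fromList; lookup)
open import Data.Product using (Σ; ∃; _×_)
open import Relation.Binary.PropositionalEquality using (_≡_)
open import Relation.Nullary using (¬_)

linComb : ∀ {ℓ n} → Vec (Vec ℤ ℓ) n → Vec ℤ n → Vec ℤ ℓ
linComb {ℓ} [] [] = replicate ℓ 0ℤ
linComb (v ∷ vs) (c ∷ cs) = zipWith _+_ (map (c *_) v) (linComb vs cs)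

InSubgroup : ∀ {ℓ} → List (Vec ℤ ℓ) → Vec ℤ ℓ → Set
InSubgroup {ℓ} 𝒜 v = Σ (Vec ℤ (length 𝒜)) λ cs → linComb (fromList 𝒜) cs ≡ v

LinIndep : ∀ {ℓ r} → Vec (Vec ℤ ℓ) r → Set
LinIndep {ℓ} {r} w = (cs : Vec ℤ r) → linComb w cs ≡ replicate ℓ 0ℤ → cs ≡ replicate r 0ℤ

-- rank of the (free abelian) group ⟨𝒜⟩ equals r :
-- maximal size of a ℤ-linearly independent family of elements of ⟨𝒜⟩
HasRank : ∀ {ℓ} → List (Vec ℤ ℓ) → ℕ → Set
HasRank {ℓ} 𝒜 r =
  (Σ (Vec (Vec ℤ ℓ) r) λ w → ((i : Fin r) → InSubgroup 𝒜 (lookup w i)) × LinIndep w)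
  × ((w : Vec (Vec ℤ ℓ) (suc r)) → ((i : Fin (suc r)) → InSubgroup 𝒜 (lookup w i)) → ¬ LinIndep w)

-- product z · α of a row vector z ∈ (ℤ/qℤ)^ℓ (residues represented by Fin q) with α ∈ ℤ^ℓ,
-- computed in ℤ (to be read modulo q)
dot : ∀ {ℓ q} → Vec (Fin q) ℓ → Vec ℤ ℓ → ℤ
dot z a = foldr _ _+_ 0ℤ (zipWith (λ zi ai → (+ toℕ zi) * ai) z a)

InCW : ∀ {ℓ} → List (Vec ℤ ℓ) → List (Vec ℤ ℓ) → (q : ℕ) → Vec (Fin q) ℓ → Set
InCW 𝒜 ℬ q z = All (λ α → ¬ ((+ q) ∣ dot z α)) 𝒜 × All (λ β → (+ q) ∣ dot z β) ℬ

CWEmpty : ∀ {ℓ} → List (Vec ℤ ℓ) → List (Vec ℤ ℓ) → ℕ → Set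
CWEmpty {ℓ} 𝒜 ℬ q = ¬ (Σ (Vec (Fin q) ℓ) λ z → InCW 𝒜 ℬ q z)

P : ℕ → Set
P ℓ = (𝒜₁ 𝒜₂ : List (Vec ℤ ℓ)) → HasRank 𝒜₂ ℓ
    → ((q : ℕ) → 1 Data.Nat.≤ q → CWEmpty 𝒜₁ 𝒜₂ q)
    → Σ (Vec ℤ ℓ) λ α → α ∈ 𝒜₁ × InSubgroup 𝒜₂ α

-- For ℓ = 1 the subgroup ⟨𝒜₂⟩ is gℤ, where g is the gcd of the entries of 𝒜₂ (built from Bézout's
-- identity); g ≠ 0 because ⟨𝒜₂⟩ has rank 1. For q = g and z the residue of 1, every β ∈ 𝒜₂ has
-- z · β ≡ 0, so emptiness of CW(𝒜₁, 𝒜₂; g) yields some α ∈ 𝒜₁ with g ∣ α, that is α ∈ ⟨𝒜₂⟩.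
--
-- For ℓ ≥ 2 take 𝒜₂ the columns of diag(2, 2, 1, …, 1) and 𝒜₁ = {e₁, e₂, e₁ + e₂}. Every element of
-- ⟨𝒜₂⟩ has even first and second coordinates, so no α ∈ 𝒜₁ lies in it. If z · 2e₁ ≡ z · 2e₂ ≡ 0 but
-- z · e₁, z · e₂ ≢ 0 (mod q), then both residues z₁ and z₂ equal q/2, hence z · (e₁ + e₂) ≡ 0, so every
-- CW(𝒜₁, 𝒜₂; q) is empty. That ⟨𝒜₂⟩ has rank exactly ℓ rests on the fact that any ℓ + 1 vectors of
-- ℤ^ℓ are linearly dependent, proved by eliminating the first coordinate against a pivot.
module Submission where

open import Defs
open import Data.Nat using (ℕ; _≤_)
open import Relation.Binary.PropositionalEquality using (_≡_)
open import Data.Product using (_×_)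

open import Data.Empty using (⊥-elim)
open import Data.Fin using (Fin; zero; suc; punchIn; toℕ)
open import Data.Fin.Properties using (toℕ<n)
open import Data.Integer as ℤ using (ℤ; ∣_∣; +_; -[1+_]; _+_; _-_; _*_; -_; 0ℤ; 1ℤ; -1ℤ)
open import Data.Integer.Divisibility using () renaming (_∣_ to _∣ᵤ_)
import Data.Integer.Divisibility.Signed as S
open S using (_∣_)
import Data.Integer.Properties as ℤP
open import Data.Integer.Tactic.RingSolver using (solve-∀)
open import Data.List using (List; []; _∷_; length)
open import Data.List.Membership.Propositional using (_∈_; find)
open import Data.List.Relation.Unary.All as All using (All; []; _∷_)
open import Data.List.Relation.Unary.All.Properties using (¬Any⇒All¬)
open import Data.List.Relation.Unary.Any using (here; there; any?)
open import Data.Nat as ℕ using (zero; suc; _<_; s≤s; z≤n)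
import Data.Nat.Divisibility as ND
open import Data.Nat.GCD using (gcd; gcd-GCD; gcd[m,n]∣m; gcd[m,n]∣n; module Bézout)
import Data.Nat.Properties as ℕP
import Data.Nat.Tactic.RingSolver as ℕ-Solver
open import Data.Product using (∃; ∃₂; _,_)
open import Data.Sum using (_⊎_; inj₁; inj₂; [_,_])
open import Data.Vec using (Vec; []; _∷_; replicate; zipWith; map; lookup; head; tail; insertAt; removeAt; fromList; toList)
open import Data.Vec.Membership.Propositional.Properties using (∈-toList⁺; ∈-lookup)
open import Data.Vec.Properties
  using (∷-injectiveˡ; ∷-injectiveʳ; map-replicate; map-cong; map-id; lookup-map; lookup-replicate; insertAt-punchIn; insertAt-removeAt)
import Data.Vec.Relation.Unary.All as AllV
import Data.Vec.Relation.Unary.All.Properties as AllV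
open import Function using (_∘_)
open import Relation.Binary.PropositionalEquality using (refl; sym; trans; cong; cong₂; subst; _≢_; module ≡-Reasoning)
open import Relation.Nullary using (¬_; yes; no; contradiction)

-- Linear combinations in ℤⁿ

infixl 6 _⊕_
infixr 7 _·_

_⊕_ : ∀ {n} → Vec ℤ n → Vec ℤ n → Vec ℤ n
_⊕_ = zipWith _+_

_·_ : ∀ {n} → ℤ → Vec ℤ n → Vec ℤ n
a · u = map (a *_) u

⊕-comm : ∀ {n} (u v : Vec ℤ n) → u ⊕ v ≡ v ⊕ u
⊕-comm []      []      = refl
⊕-comm (x ∷ u) (y ∷ v) = cong₂ _∷_ (ℤP.+-comm x y) (⊕-comm u v)

⊕-swap : ∀ {n} (u v w : Vec ℤ n) → u ⊕ (v ⊕ w) ≡ v ⊕ (u ⊕ w)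
⊕-swap []      []      []      = refl
⊕-swap (x ∷ u) (y ∷ v) (z ∷ w) = cong₂ _∷_ (swap x y z) (⊕-swap u v w)
  where
  swap : ∀ x y z → x + (y + z) ≡ y + (x + z)
  swap = solve-∀

⊕-identityˡ : ∀ {n} (u : Vec ℤ n) → replicate n 0ℤ ⊕ u ≡ u
⊕-identityˡ []      = refl
⊕-identityˡ (x ∷ u) = cong₂ _∷_ (ℤP.+-identityˡ x) (⊕-identityˡ u)

⊕-identityʳ : ∀ {n} (u : Vec ℤ n) → u ⊕ replicate n 0ℤ ≡ u
⊕-identityʳ u = trans (⊕-comm u _) (⊕-identityˡ u)

·-zeroʳ : ∀ {n} a → a · replicate n 0ℤ ≡ replicate n 0ℤ
·-zeroʳ {n} a = trans (map-replicate (a *_) 0ℤ n) (cong (replicate n) (ℤP.*-zeroʳ a))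

·-identityˡ : ∀ {n} (u : Vec ℤ n) → 1ℤ · u ≡ u
·-identityˡ u = trans (map-cong ℤP.*-identityˡ u) (map-id u)

0·-⊕ : ∀ {n} (u v : Vec ℤ n) → 0ℤ · u ⊕ v ≡ v
0·-⊕ []      []      = refl
0·-⊕ (x ∷ u) (y ∷ v) = cong₂ _∷_ (ℤP.+-identityˡ y) (0·-⊕ u v)

·-⊕-assoc : ∀ {n} a c (u v : Vec ℤ n) → (a * c) · u ⊕ a · v ≡ a · (c · u ⊕ v)
·-⊕-assoc a c []      []      = refl
·-⊕-assoc a c (x ∷ u) (y ∷ v) = cong₂ _∷_ (distrib a c x y) (·-⊕-assoc a c u v)
  where
  distrib : ∀ a c x y → a * c * x + a * y ≡ a * (c * x + y)
  distrib = solve-∀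

lookup-·⊕ : ∀ {n} a (u v : Vec ℤ n) i → lookup (a · u ⊕ v) i ≡ a * lookup u i + lookup v i
lookup-·⊕ a (x ∷ u) (y ∷ v) zero    = refl
lookup-·⊕ a (x ∷ u) (y ∷ v) (suc i) = lookup-·⊕ a u v i

linComb-zero : ∀ {ℓ n} (w : Vec (Vec ℤ ℓ) n) → linComb w (replicate n 0ℤ) ≡ replicate ℓ 0ℤ
linComb-zero []      = refl
linComb-zero (u ∷ w) = trans (0·-⊕ u _) (linComb-zero w)

linComb-scale : ∀ {ℓ n} a (w : Vec (Vec ℤ ℓ) n) cs → linComb w (a · cs) ≡ a · linComb w cs
linComb-scale a []      []       = sym (·-zeroʳ a)
linComb-scale a (u ∷ w) (c ∷ cs) =
  trans (cong ((a * c) · u ⊕_) (linComb-scale a w cs)) (·-⊕-assoc a c u (linComb w cs))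

linComb-insertAt : ∀ {ℓ n} (w : Vec (Vec ℤ ℓ) n) cs j u c →
                   linComb (insertAt w j u) (insertAt cs j c) ≡ c · u ⊕ linComb w cs
linComb-insertAt w       cs       zero    u c = refl
linComb-insertAt (v ∷ w) (d ∷ cs) (suc j) u c =
  trans (cong (d · v ⊕_) (linComb-insertAt w cs j u c)) (⊕-swap (d · v) (c · u) (linComb w cs))

record IsLinear {m k} (φ : Vec ℤ m → Vec ℤ k) : Set where
  field
    map-zero        : φ (replicate m 0ℤ) ≡ replicate k 0ℤ
    map-combination : ∀ c u v → φ (c · u ⊕ v) ≡ c · φ u ⊕ φ v

linComb-map : ∀ {m k n} {φ : Vec ℤ m → Vec ℤ k} → IsLinear φ →
              ∀ (w : Vec (Vec ℤ m) n) cs → linComb (map φ w) cs ≡ φ (linComb w cs)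
linComb-map φ-linear []      []       = sym (IsLinear.map-zero φ-linear)
linComb-map φ-linear (u ∷ w) (c ∷ cs) =
  trans (cong (_ ⊕_) (linComb-map φ-linear w cs)) (sym (IsLinear.map-combination φ-linear c u _))

cons-zero-linear : ∀ {m} → IsLinear {m} (0ℤ ∷_)
cons-zero-linear = record
  { map-zero        = refl
  ; map-combination = λ c u v → cong (_∷ c · u ⊕ v) (sym (trans (ℤP.+-identityʳ (c * 0ℤ)) (ℤP.*-zeroʳ c)))
  }

linComb-unit : ∀ {ℓ n} (u : Vec ℤ ℓ) (w : Vec (Vec ℤ ℓ) n) → linComb (u ∷ w) (1ℤ ∷ replicate n 0ℤ) ≡ u
linComb-unit u w = trans (cong (1ℤ · u ⊕_) (linComb-zero w)) (trans (⊕-identityʳ _) (·-identityˡ u))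

∈⇒InSubgroup : ∀ {ℓ} {L : List (Vec ℤ ℓ)} {v} → v ∈ L → InSubgroup L v
∈⇒InSubgroup {L = _ ∷ L} (here refl) = 1ℤ ∷ replicate (length L) 0ℤ , linComb-unit _ (fromList L)
∈⇒InSubgroup {L = u ∷ _} (there v∈L) with ∈⇒InSubgroup v∈L
... | cs , combination = 0ℤ ∷ cs , trans (0·-⊕ u _) combination

InSubgroup-scale : ∀ {ℓ} {L : List (Vec ℤ ℓ)} {v} a → InSubgroup L v → InSubgroup L (a · v)
InSubgroup-scale {L = L} a (cs , refl) = a · cs , linComb-scale a (fromList L) cs

-- Any ℓ + 1 vectors of ℤ^ℓ are linearly dependent

Nontrivial : ∀ {n} → Vec ℤ n → Set
Nontrivial cs = ∃ λ i → lookup cs i ≢ 0ℤ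

LinDep : ∀ {ℓ n} → Vec (Vec ℤ ℓ) n → Set
LinDep {ℓ} w = ∃ λ cs → linComb w cs ≡ replicate ℓ 0ℤ × Nontrivial cs

LinDep⇒¬LinIndep : ∀ {ℓ n} {w : Vec (Vec ℤ ℓ) n} → LinDep w → ¬ LinIndep w
LinDep⇒¬LinIndep (cs , relation , i , cᵢ≢0) independent =
  cᵢ≢0 (trans (cong (λ ds → lookup ds i) (independent cs relation)) (lookup-replicate i 0ℤ))

*-≢0 : ∀ {a b} → a ≢ 0ℤ → b ≢ 0ℤ → a * b ≢ 0ℤ
*-≢0 {a} a≢0 b≢0 ab≡0 = [ a≢0 , b≢0 ] (ℤP.i*j≡0⇒i≡0∨j≡0 a ab≡0)

pivot-or-zero-heads : ∀ {ℓ n} (w : Vec (Vec ℤ (suc ℓ)) n) →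
                      (∃ λ j → head (lookup w j) ≢ 0ℤ) ⊎ AllV.All (λ u → head u ≡ 0ℤ) w
pivot-or-zero-heads []      = inj₂ AllV.[]
pivot-or-zero-heads (u ∷ w) with head u ℤ.≟ 0ℤ | pivot-or-zero-heads w
... | no  h≢0 | _              = inj₁ (zero , h≢0)
... | yes _   | inj₁ (j , h≢0) = inj₁ (suc j , h≢0)
... | yes h≡0 | inj₂ heads     = inj₂ (h≡0 AllV.∷ heads)

zero-heads : ∀ {ℓ n} (w : Vec (Vec ℤ (suc ℓ)) n) → AllV.All (λ u → head u ≡ 0ℤ) w → w ≡ map (0ℤ ∷_) (map tail w)
zero-heads []              AllV.[]           = refl
zero-heads ((_ ∷ _) ∷ w) (refl AllV.∷ heads) = cong (_ ∷_) (zero-heads w heads)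

eliminate : ∀ {ℓ} → Vec ℤ (suc ℓ) → Vec ℤ (suc ℓ) → Vec ℤ ℓ
eliminate p u = head p · tail u ⊕ (- head u) · tail p

eliminate-linear : ∀ {ℓ} (p : Vec ℤ (suc ℓ)) → IsLinear (eliminate p)
eliminate-linear (a ∷ t) = record
  { map-zero        = trans (⊕-comm (a · replicate _ 0ℤ) _) (trans (0·-⊕ t _) (·-zeroʳ a))
  ; map-combination = λ { c (x ∷ u) (y ∷ v) → combination c x y u v t }
  }
  where
  combination : ∀ {n} c x y (u v t : Vec ℤ n) →
    a · (c · u ⊕ v) ⊕ (- (c * x + y)) · t ≡ c · (a · u ⊕ (- x) · t) ⊕ (a · v ⊕ (- y) · t)
  combination c x y []      []      []      = refl
  combination c x y (u₀ ∷ u) (v₀ ∷ v) (t₀ ∷ t) = cong₂ _∷_ (ring a c x y u₀ v₀ t₀) (combination c x y u v t)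
    where
    ring : ∀ a c x y u v t → a * (c * u + v) + (- (c * x + y)) * t ≡ c * (a * u + (- x) * t) + (a * v + (- y) * t)
    ring = solve-∀

pivot-combination : ∀ {ℓ} (p u : Vec ℤ (suc ℓ)) → (- head u) · p ⊕ head p · u ≡ 0ℤ ∷ eliminate p u
pivot-combination (a ∷ t) (x ∷ u) = cong₂ _∷_ (cancel a x) (⊕-comm ((- x) · t) (a · u))
  where
  cancel : ∀ a x → (- x) * a + a * x ≡ 0ℤ
  cancel = solve-∀

ManyDependent : ℕ → Set
ManyDependent ℓ = ∀ {n} → ℓ < n → (w : Vec (Vec ℤ ℓ) n) → LinDep w

pivot-relation : ∀ {ℓ n} (rest : Vec (Vec ℤ (suc ℓ)) n) j p ds →
  linComb (map (eliminate p) rest) ds ≡ replicate ℓ 0ℤ →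
  linComb (insertAt rest j p) (insertAt (head p · ds) j (- head (linComb rest ds))) ≡ replicate (suc ℓ) 0ℤ
pivot-relation {ℓ} rest j p ds relation = begin
  linComb (insertAt rest j p) (insertAt (head p · ds) j (- head L))
    ≡⟨ linComb-insertAt rest (head p · ds) j p (- head L) ⟩
  (- head L) · p ⊕ linComb rest (head p · ds)
    ≡⟨ cong ((- head L) · p ⊕_) (linComb-scale (head p) rest ds) ⟩
  (- head L) · p ⊕ head p · L
    ≡⟨ pivot-combination p L ⟩
  0ℤ ∷ eliminate p L
    ≡⟨ cong (0ℤ ∷_) (trans (sym (linComb-map (eliminate-linear p) rest ds)) relation) ⟩
  0ℤ ∷ replicate ℓ 0ℤ ∎
  where
  open ≡-Reasoning
  L = linComb rest ds

pivot-dependent : ∀ {ℓ m} → ManyDependent ℓ → ℓ < m → (w : Vec (Vec ℤ (suc ℓ)) (suc m)) (j : Fin (suc m)) →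
                  head (lookup w j) ≢ 0ℤ → LinDep w
pivot-dependent dependent ℓ<m w j a≢0 with dependent ℓ<m (map (eliminate (lookup w j)) (removeAt w j))
... | ds , relation , i , dᵢ≢0 =
  subst LinDep (insertAt-removeAt w j)
    ( insertAt (head p · ds) j (- head (linComb rest ds))
    , pivot-relation rest j p ds relation
    , punchIn j i
    , λ cᵢ≡0 → *-≢0 a≢0 dᵢ≢0 (trans (sym (lookup-map i (head p *_) ds))
                                    (trans (sym (insertAt-punchIn (head p · ds) j _ i)) cᵢ≡0)))
  where
  p = lookup w j
  rest = removeAt w j

zero-heads-dependent : ∀ {ℓ n} → ManyDependent ℓ → ℓ < n → (w : Vec (Vec ℤ (suc ℓ)) n) →
                       AllV.All (λ u → head u ≡ 0ℤ) w → LinDep w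
zero-heads-dependent dependent ℓ<n w heads with dependent ℓ<n (map tail w)
... | ds , relation , nontrivial =
  subst LinDep (sym (zero-heads w heads))
    (ds , trans (linComb-map cons-zero-linear (map tail w) ds) (cong (0ℤ ∷_) relation) , nontrivial)

empty-vector : ∀ {A : Set} (v : Vec A 0) → v ≡ []
empty-vector [] = refl

many-vectors-dependent : ∀ ℓ → ManyDependent ℓ
many-vectors-dependent zero    {suc n} _ w = 1ℤ ∷ replicate n 0ℤ , empty-vector _ , zero , λ ()
many-vectors-dependent (suc ℓ) {suc m} (s≤s ℓ<m) w with pivot-or-zero-heads w
... | inj₁ (j , a≢0) = pivot-dependent (many-vectors-dependent ℓ) ℓ<m w j a≢0
... | inj₂ heads     = zero-heads-dependent (many-vectors-dependent ℓ) (ℕP.m<n⇒m<1+n ℓ<m) w heads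

-- Rank and coordinates of the span of a diagonal family

∣0 : ∀ {k} → k ∣ 0ℤ
∣0 = S.divides 0ℤ refl

independent-hasRank : ∀ {ℓ} (W : Vec (Vec ℤ ℓ) ℓ) → LinIndep W → HasRank (toList W) ℓ
independent-hasRank {ℓ} W independent =
  (W , (λ i → ∈⇒InSubgroup (∈-toList⁺ (∈-lookup i W))) , independent) ,
  λ w _ → LinDep⇒¬LinIndep {w = w} (many-vectors-dependent ℓ (ℕP.n<1+n ℓ) w)

diagonal : ∀ {n} → Vec ℤ n → Vec (Vec ℤ n) n
diagonal             []       = []
diagonal {suc n} (d ∷ ds) = (d ∷ replicate n 0ℤ) ∷ map (0ℤ ∷_) (diagonal ds)

linComb-diagonal : ∀ {n} (ds cs : Vec ℤ n) → linComb (diagonal ds) cs ≡ zipWith _*_ cs ds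
linComb-diagonal         []       []       = refl
linComb-diagonal {suc n} (d ∷ ds) (c ∷ cs) = begin
  c · (d ∷ replicate n 0ℤ) ⊕ linComb (map (0ℤ ∷_) (diagonal ds)) cs
    ≡⟨ cong (c · (d ∷ replicate n 0ℤ) ⊕_) (linComb-map cons-zero-linear (diagonal ds) cs) ⟩
  (c * d + 0ℤ) ∷ (c · replicate n 0ℤ ⊕ linComb (diagonal ds) cs)
    ≡⟨ cong₂ _∷_ (ℤP.+-identityʳ (c * d))
                 (trans (cong₂ _⊕_ (·-zeroʳ c) (linComb-diagonal ds cs)) (⊕-identityˡ _)) ⟩
  c * d ∷ zipWith _*_ cs ds ∎
  where open ≡-Reasoning

diagonal-independent : ∀ {n} (ds : Vec ℤ n) → AllV.All (_≢ 0ℤ) ds → LinIndep (diagonal ds)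
diagonal-independent ds nonzero cs relation = cancel ds nonzero cs (trans (sym (linComb-diagonal ds cs)) relation)
  where
  cancel : ∀ {n} (ds : Vec ℤ n) → AllV.All (_≢ 0ℤ) ds → ∀ cs → zipWith _*_ cs ds ≡ replicate n 0ℤ → cs ≡ replicate n 0ℤ
  cancel []       AllV.[]              []       _  = refl
  cancel (d ∷ ds) (d≢0 AllV.∷ nonzero) (c ∷ cs) eq with ℤP.i*j≡0⇒i≡0∨j≡0 c (∷-injectiveˡ eq)
  ... | inj₁ c≡0 = cong₂ _∷_ c≡0 (cancel ds nonzero cs (∷-injectiveʳ eq))
  ... | inj₂ d≡0 = ⊥-elim (d≢0 d≡0)

diagonal-coordinate-∣ : ∀ {n} (ds : Vec ℤ n) j → AllV.All (λ u → lookup ds j ∣ lookup u j) (diagonal ds)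
diagonal-coordinate-∣ (d ∷ ds) zero    = S.∣-refl AllV.∷ AllV.map⁺ (AllV.universal (λ _ → ∣0) _)
diagonal-coordinate-∣ (d ∷ ds) (suc j) =
  subst (lookup ds j ∣_) (sym (lookup-replicate j 0ℤ)) ∣0 AllV.∷ AllV.map⁺ (diagonal-coordinate-∣ ds j)

span-coordinate-∣ : ∀ {ℓ} k j {L : List (Vec ℤ ℓ)} → All (λ u → k ∣ lookup u j) L →
                    ∀ {v} → InSubgroup L v → k ∣ lookup v j
span-coordinate-∣ k j divisible (cs , refl) = go divisible cs
  where
  go : ∀ {L} → All (λ u → k ∣ lookup u j) L → ∀ cs → k ∣ lookup (linComb (fromList L) cs) j
  go []                  []       = subst (k ∣_) (sym (lookup-replicate j 0ℤ)) ∣0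
  go {u ∷ L} (k∣u ∷ divisible) (c ∷ cs) =
    subst (k ∣_) (sym (lookup-·⊕ c u _ j)) (S.∣m∣n⇒∣m+n (S.∣n⇒∣m*n c k∣u) (go divisible cs))

-- The statement fails for ℓ ≥ 2

dot-zeroʳ : ∀ {n q} (z : Vec (Fin q) n) → dot z (replicate n 0ℤ) ≡ 0ℤ
dot-zeroʳ []      = refl
dot-zeroʳ (x ∷ z) = trans (cong (λ t → + toℕ x * 0ℤ + t) (dot-zeroʳ z)) (trans (ℤP.+-identityʳ _) (ℤP.*-zeroʳ (+ toℕ x)))

two-torsion : ∀ {q a} → a < q → q ND.∣ a ℕ.* 2 → ¬ q ND.∣ a → a ℕ.* 2 ≡ q
two-torsion {q} {a} a<q (ND.divides 0 2a≡0) q∤a =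
  ⊥-elim (q∤a (subst (q ND.∣_) (sym (ℕP.m*n≡0⇒m≡0 a 2 2a≡0)) (q ND.∣0)))
two-torsion {q} {a} a<q (ND.divides 1 2a≡q) q∤a = trans 2a≡q (ℕP.+-identityʳ q)
two-torsion {q} {a} a<q (ND.divides (suc (suc k)) 2a≡kq) q∤a = ⊥-elim (ℕP.<-irrefl 2a≡kq (begin-strict
  a ℕ.* 2             <⟨ ℕP.*-monoˡ-< 2 a<q ⟩
  q ℕ.* 2             ≡⟨ ℕP.*-comm q 2 ⟩
  2 ℕ.* q             ≤⟨ ℕP.*-monoˡ-≤ q (ℕP.m≤m+n 2 k) ⟩
  suc (suc k) ℕ.* q   ∎))
  where open ℕP.≤-Reasoning

2∤1 : ¬ + 2 ∣ + 1
2∤1 2∣1 with ND.∣1⇒≡1 (S.∣⇒∣ᵤ 2∣1)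
... | ()

module Counterexample (m : ℕ) where

  pair : ℕ → ℕ → Vec ℤ (2 ℕ.+ m)
  pair x y = + x ∷ + y ∷ replicate m 0ℤ

  𝒜₁ : List (Vec ℤ (2 ℕ.+ m))
  𝒜₁ = pair 1 0 ∷ pair 0 1 ∷ pair 1 1 ∷ []

  scales : Vec ℤ (2 ℕ.+ m)
  scales = + 2 ∷ + 2 ∷ replicate m 1ℤ

  𝒜₂ : List (Vec ℤ (2 ℕ.+ m))
  𝒜₂ = toList (diagonal scales)

  scales-nonzero : AllV.All (_≢ 0ℤ) scales
  scales-nonzero = (λ ()) AllV.∷ (λ ()) AllV.∷ AllV.lookup⁻ λ i 1≡0 →
                   contradiction (trans (sym (lookup-replicate i 1ℤ)) 1≡0) λ ()

  𝒜₂-rank : HasRank 𝒜₂ (2 ℕ.+ m)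
  𝒜₂-rank = independent-hasRank (diagonal scales) (diagonal-independent scales scales-nonzero)

  coordinate-∣ : ∀ j {v} → InSubgroup 𝒜₂ v → lookup scales j ∣ lookup v j
  coordinate-∣ j = span-coordinate-∣ (lookup scales j) j (AllV.toList⁺ (diagonal-coordinate-∣ scales j))

  𝒜₁-outside : ∀ {α} → α ∈ 𝒜₁ → ¬ InSubgroup 𝒜₂ α
  𝒜₁-outside (here refl)                 = 2∤1 ∘ coordinate-∣ zero
  𝒜₁-outside (there (here refl))         = 2∤1 ∘ coordinate-∣ (suc zero)
  𝒜₁-outside (there (there (here refl))) = 2∤1 ∘ coordinate-∣ zero

  dot-pair : ∀ {q} (z₁ z₂ : Fin q) zs x y → dot (z₁ ∷ z₂ ∷ zs) (pair x y) ≡ + (toℕ z₁ ℕ.* x ℕ.+ toℕ z₂ ℕ.* y)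
  dot-pair z₁ z₂ zs x y = begin
    + toℕ z₁ * + x + (+ toℕ z₂ * + y + dot zs (replicate m 0ℤ)) ≡⟨ cong (λ t → + toℕ z₁ * + x + t)
                                                                      (trans (cong (λ t → + toℕ z₂ * + y + t) (dot-zeroʳ zs)) (ℤP.+-identityʳ _)) ⟩
    + toℕ z₁ * + x + + toℕ z₂ * + y                            ≡⟨ sym (cong₂ _+_ (ℤP.pos-* (toℕ z₁) x) (ℤP.pos-* (toℕ z₂) y)) ⟩
    + (toℕ z₁ ℕ.* x) + + (toℕ z₂ ℕ.* y)                        ≡⟨ sym (ℤP.pos-+ (toℕ z₁ ℕ.* x) (toℕ z₂ ℕ.* y)) ⟩
    + (toℕ z₁ ℕ.* x ℕ.+ toℕ z₂ ℕ.* y)                          ∎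
    where open ≡-Reasoning

  residues-sum : ∀ {q a b} → a < q → b < q →
                 q ND.∣ a ℕ.* 2 ℕ.+ b ℕ.* 0 → q ND.∣ a ℕ.* 0 ℕ.+ b ℕ.* 2 →
                 ¬ q ND.∣ a ℕ.* 1 ℕ.+ b ℕ.* 0 → ¬ q ND.∣ a ℕ.* 0 ℕ.+ b ℕ.* 1 → q ND.∣ a ℕ.* 1 ℕ.+ b ℕ.* 1
  residues-sum {q} {a} {b} a<q b<q q∣2a q∣2b q∤a q∤b = subst (q ND.∣_) (sym a+b≡q) ND.∣-refl
    where
    left : ∀ a b → a ℕ.* 2 ℕ.+ b ℕ.* 0 ≡ a ℕ.* 2
    left = ℕ-Solver.solve-∀
    right : ∀ a b → a ℕ.* 0 ℕ.+ b ℕ.* 2 ≡ b ℕ.* 2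
    right = ℕ-Solver.solve-∀
    left₁ : ∀ a b → a ℕ.* 1 ℕ.+ b ℕ.* 0 ≡ a
    left₁ = ℕ-Solver.solve-∀
    right₁ : ∀ a b → a ℕ.* 0 ℕ.+ b ℕ.* 1 ≡ b
    right₁ = ℕ-Solver.solve-∀
    double : ∀ a → a ℕ.* 1 ℕ.+ a ℕ.* 1 ≡ a ℕ.* 2
    double = ℕ-Solver.solve-∀
    2a≡q : a ℕ.* 2 ≡ q
    2a≡q = two-torsion a<q (subst (q ND.∣_) (left a b) q∣2a) (q∤a ∘ subst (q ND.∣_) (sym (left₁ a b)))
    2b≡q : b ℕ.* 2 ≡ q
    2b≡q = two-torsion b<q (subst (q ND.∣_) (right a b) q∣2b) (q∤b ∘ subst (q ND.∣_) (sym (right₁ a b)))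
    a+b≡q : a ℕ.* 1 ℕ.+ b ℕ.* 1 ≡ q
    a+b≡q rewrite ℕP.*-cancelʳ-≡ b a 2 (trans 2b≡q (sym 2a≡q)) = trans (double a) 2a≡q

  cw-empty : ∀ q → 1 ≤ q → CWEmpty 𝒜₁ 𝒜₂ q
  cw-empty q _ (z₁ ∷ z₂ ∷ zs , (q∤e₁ ∷ q∤e₂ ∷ q∤e₁₂ ∷ []) , (q∣2e₁ ∷ q∣2e₂ ∷ _)) =
    q∤e₁₂ (to (residues-sum (toℕ<n z₁) (toℕ<n z₂) (from q∣2e₁) (from q∣2e₂) (q∤e₁ ∘ to) (q∤e₂ ∘ to)))
    where
    from : ∀ {x y} → + q ∣ᵤ dot (z₁ ∷ z₂ ∷ zs) (pair x y) → q ND.∣ toℕ z₁ ℕ.* x ℕ.+ toℕ z₂ ℕ.* y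
    from = subst (q ND.∣_) (cong ∣_∣ (dot-pair z₁ z₂ zs _ _))
    to : ∀ {x y} → q ND.∣ toℕ z₁ ℕ.* x ℕ.+ toℕ z₂ ℕ.* y → + q ∣ᵤ dot (z₁ ∷ z₂ ∷ zs) (pair x y)
    to = subst (q ND.∣_) (cong ∣_∣ (sym (dot-pair z₁ z₂ zs _ _)))

¬P[2+m] : ∀ m → ¬ P (2 ℕ.+ m)
¬P[2+m] m P[2+m] with P[2+m] 𝒜₁ 𝒜₂ 𝒜₂-rank cw-empty
  where open Counterexample m
... | α , α∈𝒜₁ , α∈span = Counterexample.𝒜₁-outside m α∈𝒜₁ α∈span

-- The statement holds for ℓ = 1

abs-as-multiple : ∀ i → ∃ λ s → + ∣ i ∣ ≡ s * i
abs-as-multiple (+ n)    = 1ℤ , sym (ℤP.*-identityˡ (+ n))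
abs-as-multiple -[1+ n ] = -1ℤ , sym (ℤP.-1*i≡-i -[1+ n ])

pos-identity : ∀ {d x y u v} → d ℕ.+ x ℕ.* u ≡ y ℕ.* v → + d + + x * + u ≡ + y * + v
pos-identity {d} {x} {y} {u} {v} eq = begin
  + d + + x * + u   ≡⟨ cong (_+_ (+ d)) (sym (ℤP.pos-* x u)) ⟩
  + d + + (x ℕ.* u) ≡⟨ sym (ℤP.pos-+ d (x ℕ.* u)) ⟩
  + (d ℕ.+ x ℕ.* u) ≡⟨ cong +_ eq ⟩
  + (y ℕ.* v)       ≡⟨ ℤP.pos-* y v ⟩
  + y * + v         ∎
  where open ≡-Reasoning

bézout : ∀ a b → ∃₂ λ x y → x * a + y * + b ≡ + gcd ∣ a ∣ b
bézout a b with abs-as-multiple a | Bézout.identity (gcd-GCD ∣ a ∣ b)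
... | s , ∣a∣≡sa | Bézout.+- x y eq = + x * s , - + y , (begin
  + x * s * a + - + y * + b       ≡⟨ regroup (+ x) s a (+ y) (+ b) ⟩
  + x * (s * a) - + y * + b       ≡⟨ cong (λ t → + x * t - + y * + b) (sym ∣a∣≡sa) ⟩
  + x * + ∣ a ∣ - + y * + b       ≡⟨ cong (_- + y * + b) (sym (pos-identity {d} {y} {x} {b} eq)) ⟩
  + d + + y * + b - + y * + b     ≡⟨ cancel (+ d) (+ y * + b) ⟩
  + d                             ∎)
  where
  open ≡-Reasoning
  d = gcd ∣ a ∣ b
  regroup : ∀ x s a y b → x * s * a + - y * b ≡ x * (s * a) - y * b
  regroup = solve-∀
  cancel : ∀ d e → d + e - e ≡ d
  cancel = solve-∀
... | s , ∣a∣≡sa | Bézout.-+ x y eq = - + x * s , + y , (begin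
  - + x * s * a + + y * + b       ≡⟨ regroup (+ x) s a (+ y) (+ b) ⟩
  + y * + b - + x * (s * a)       ≡⟨ cong (λ t → + y * + b - + x * t) (sym ∣a∣≡sa) ⟩
  + y * + b - + x * + ∣ a ∣       ≡⟨ cong (_- + x * + ∣ a ∣) (sym (pos-identity {d} {x} {y} {∣ a ∣} eq)) ⟩
  + d + + x * + ∣ a ∣ - + x * + ∣ a ∣ ≡⟨ cancel (+ d) (+ x * + ∣ a ∣) ⟩
  + d                             ∎)
  where
  open ≡-Reasoning
  d = gcd ∣ a ∣ b
  regroup : ∀ x s a y b → - x * s * a + y * b ≡ y * b - x * (s * a)
  regroup = solve-∀
  cancel : ∀ d e → d + e - e ≡ d
  cancel = solve-∀

cyclic-span : (L : List (Vec ℤ 1)) → ∃ λ g → InSubgroup L (+ g ∷ []) × All (λ u → + g ∣ lookup u zero) L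
cyclic-span []             = 0 , ([] , refl) , []
cyclic-span ((c ∷ []) ∷ L) with cyclic-span L
... | g , (cs , g∈L) , g∣L with bézout c g
...   | x , y , combination =
  gcd ∣ c ∣ g ,
  (x ∷ y · cs , spans) ,
  S.∣ᵤ⇒∣ (gcd[m,n]∣m ∣ c ∣ g) ∷ All.map (S.∣-trans (S.∣ᵤ⇒∣ (gcd[m,n]∣n ∣ c ∣ g))) g∣L
  where
  open ≡-Reasoning
  spans : x · (c ∷ []) ⊕ linComb (fromList L) (y · cs) ≡ + gcd ∣ c ∣ g ∷ []
  spans = begin
    x · (c ∷ []) ⊕ linComb (fromList L) (y · cs)
      ≡⟨ cong (x · (c ∷ []) ⊕_) (trans (linComb-scale y (fromList L) cs) (cong (y ·_) g∈L)) ⟩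
    x * c + y * + g ∷ []
      ≡⟨ cong (_∷ []) combination ⟩
    + gcd ∣ c ∣ g ∷ [] ∎

unit-residue : ∀ k → ∃ λ (z : Fin (suc k)) → ∀ a → + suc k ∣ + toℕ z * a → + suc k ∣ a
unit-residue zero    = zero , λ a _ → S.∣ᵤ⇒∣ (ND.1∣ ∣ a ∣)
unit-residue (suc k) = suc zero , λ a → subst (_ ∣_) (ℤP.*-identityˡ a)

CWEmpty-witness : ∀ {ℓ q} {𝒜₁ 𝒜₂ : List (Vec ℤ ℓ)} → CWEmpty 𝒜₁ 𝒜₂ q → (z : Vec (Fin q) ℓ) →
                  All (λ β → + q ∣ᵤ dot z β) 𝒜₂ → ∃ λ α → α ∈ 𝒜₁ × + q ∣ᵤ dot z α
CWEmpty-witness {q = q} {𝒜₁} empty z kills-𝒜₂ with any? (λ α → q ND.∣? ∣ dot z α ∣) 𝒜₁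
... | yes kills-some = find kills-some
... | no  kills-none = ⊥-elim (empty (z , ¬Any⇒All¬ 𝒜₁ kills-none , kills-𝒜₂))

independent-nonzero : ∀ {ℓ} {v : Vec ℤ ℓ} → LinIndep (v ∷ []) → v ≢ replicate ℓ 0ℤ
independent-nonzero independent refl = contradiction (independent (1ℤ ∷ []) (linComb-unit _ [])) λ ()

dot-single : ∀ {q} (z : Fin q) a → dot (z ∷ []) (a ∷ []) ≡ + toℕ z * a
dot-single z a = ℤP.+-identityʳ (+ toℕ z * a)

P-one : P 1
P-one 𝒜₁ 𝒜₂ (((h ∷ []) ∷ [] , h∈span , independent) , _) cw-empty with cyclic-span 𝒜₂
... | zero , _ , 0∣𝒜₂ =
  ⊥-elim (independent-nonzero independent (cong (_∷ []) (S.0∣⇒≡0 (span-coordinate-∣ 0ℤ zero 0∣𝒜₂ (h∈span zero)))))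
... | suc k , g∈span , g∣𝒜₂ with unit-residue k
...   | z , z-unit with CWEmpty-witness (cw-empty (suc k) (s≤s z≤n)) (z ∷ []) (All.map (λ {β} → kills {β}) g∣𝒜₂)
  where
  kills : ∀ {β} → + suc k ∣ lookup β zero → + suc k ∣ᵤ dot (z ∷ []) β
  kills {b ∷ []} g∣b = S.∣⇒∣ᵤ (subst (+ suc k ∣_) (sym (dot-single z b)) (S.∣n⇒∣m*n (+ toℕ z) g∣b))
...     | a ∷ [] , a∈𝒜₁ , q∣za with z-unit a (subst (+ suc k ∣_) (dot-single z a) (S.∣ᵤ⇒∣ q∣za))
...       | S.divides t a≡tg =
  a ∷ [] , a∈𝒜₁ , subst (InSubgroup 𝒜₂) (cong (_∷ []) (sym a≡tg)) (InSubgroup-scale {L = 𝒜₂} t g∈span)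

mainTheorem6 : (ℓ : ℕ) → 1 ≤ ℓ → (P ℓ → ℓ ≡ 1) × (ℓ ≡ 1 → P ℓ)
mainTheorem6 zero          ()
mainTheorem6 (suc zero)    _ = (λ _ → refl) , (λ _ → P-one)
mainTheorem6 (suc (suc m)) _ = (λ P[2+m] → ⊥-elim (¬P[2+m] m P[2+m])) , λ ()
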